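{- For every integer $N\ge1$, the number of snake graphs (including the single-edge snake graph) having exactly $N$ perfect matchings is equal to $\phi(N)$, where $\phi$ is Euler's totient function.
   Context: A tile is a unit square in the plane with sides parallel to the axes, regarded as a graph with 4 vertices and 4 edges. A snake graph is a planar graph consisting of tiles $G_1,\ldots,G_d$ ($d\ge1$) such that for each $i<d$, $G_i$ and $G_{i+1}$ share exactly one edge, which is either the north edge of $G_i$ and south edge of $G_{i+1}$, or the east edge of $G_i$ and west edge of $G_{i+1}$; the graph with two vertices and one edge is also a snake graph. Snake graphs are counted up to translation, i.e. a snake graph with $d$ tiles is determined by the sequence of $d-1$ choices of whether $G_{i+1}$ is attached to the north or to the east of $G_i$. A perfect matching is a set of edges such that each vertex lies in exactly one of them. -}

module Defs where

open import Data.Bool using (Bool; true; false; _∧_; if_then_else_)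
open import Data.Nat using (ℕ; zero; suc; _+_; _≡ᵇ_)
open import Data.Nat.GCD using (gcd)
open import Data.Product using (_×_; _,_; proj₁; proj₂)
open import Data.Maybe using (Maybe; just; nothing)
open import Data.List using (List; []; _∷_; _++_; map; filter; length; upTo; concatMap; deduplicateᵇ; filterᵇ; foldr)
open import Relation.Nullary.Decidable using (does)
open import Relation.Unary using (Decidable)
open import Data.Nat.Properties using (_≟_)

-- Lattice points in the plane (snake graphs are taken up to translation,
-- so we place the south-west corner of the first tile at the origin).
Point : Set
Point = ℕ × ℕ

_≡ᵖ_ : Point → Point → Bool
(a , b) ≡ᵖ (c , d) = (a ≡ᵇ c) ∧ (b ≡ᵇ d)

-- An edge is an unordered pair of points; we always store it with the
-- south/west endpoint first, so equality of edges is equality of pairs.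
Edge : Set
Edge = Point × Point

_≡ᵉ_ : Edge → Edge → Bool
(p , q) ≡ᵉ (r , s) = (p ≡ᵖ r) ∧ (q ≡ᵖ s)

record Graph : Set where
  constructor mkGraph
  field
    vertices : List Point
    edges    : List Edge
open Graph public

data Dir : Set where
  North East : Dir

-- A snake graph up to translation: either the single-edge snake graph
-- ('nothing'), or a snake graph with d = 1 + length ds tiles G₁,…,G_d
-- ('just ds'), where the i-th entry of ds says whether G_{i+1} is attached
-- to the north or to the east of G_i.
Snake : Set
Snake = Maybe (List Dir)

corners : Point → List Dir → List Point
corners p [] = p ∷ []
corners (x , y) (North ∷ ds) = (x , y) ∷ corners (x , suc y) ds
corners (x , y) (East  ∷ ds) = (x , y) ∷ corners (suc x , y) ds

tileVertices : Point → List Point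
tileVertices (x , y) = (x , y) ∷ (suc x , y) ∷ (x , suc y) ∷ (suc x , suc y) ∷ []

tileEdges : Point → List Edge
tileEdges (x , y) =
  ((x , y) , (suc x , y)) ∷
  ((x , suc y) , (suc x , suc y)) ∷
  ((x , y) , (x , suc y)) ∷
  ((suc x , y) , (suc x , suc y)) ∷ []

snakeGraph : Snake → Graph
snakeGraph nothing = mkGraph ((0 , 0) ∷ (1 , 0) ∷ []) (((0 , 0) , (1 , 0)) ∷ [])
snakeGraph (just ds) =
  mkGraph (deduplicateᵇ _≡ᵖ_ (concatMap tileVertices (corners (0 , 0) ds)))
          (deduplicateᵇ _≡ᵉ_ (concatMap tileEdges (corners (0 , 0) ds)))

allᵇ : {A : Set} → (A → Bool) → List A → Bool
allᵇ p [] = true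
allᵇ p (x ∷ xs) = p x ∧ allᵇ p xs

subsets : {A : Set} → List A → List (List A)
subsets [] = [] ∷ []
subsets (x ∷ xs) = let r = subsets xs in r ++ map (x ∷_) r

incident : Point → Edge → Bool
incident v (p , q) = (v ≡ᵖ p) Data.Bool.∨ (v ≡ᵖ q)

degreeIn : List Edge → Point → ℕ
degreeIn M v = length (filterᵇ (incident v) M)

isPerfectMatching : Graph → List Edge → Bool
isPerfectMatching G M = allᵇ (λ v → degreeIn M v ≡ᵇ 1) (vertices G)

numPerfectMatchings : Graph → ℕ
numPerfectMatchings G =
  length (filterᵇ (isPerfectMatching G) (subsets (edges G)))

φ : ℕ → ℕ
φ N = length (filter (λ k → gcd k N ≟ 1) (map suc (upTo N)))

module Submission where

-- Let (b , g) count the perfect matchings of a snake that avoid, resp. contain, the south edge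
-- of its first tile.  Two corners of the first tile are not corners of the second, and the
-- matching is forced there: a new first tile below a snake with counts (b , g) yields (g , b + g),
-- a new first tile to its left yields (b + g , b).  Starting from (1 , 1) for a single tile, these
-- moves reach every coprime pair of positive integers exactly once, as Euclid's algorithm shows,
-- and the single edge accounts for (1 , 0).  Snakes with N perfect matchings therefore correspond
-- to the b with 1 ≤ b ≤ N and gcd b (N - b) = gcd b N = 1.

open import Defs
open import Algebra.Properties.CommutativeSemigroup using (interchange)
open import Data.Bool using (Bool; true; false; _∧_; T)
open import Data.Bool.ListAction using (all)
open import Data.Bool.Properties using (T-≡; T-∧; ⇔→≡; ∧-zeroʳ)
open import Data.Empty using (⊥-elim)
open import Data.List
  using (List; []; _∷_; _++_; map; filter; filterᵇ; length; drop; foldr; concatMap; deduplicateᵇ; upTo)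
open import Data.List.Properties
  using (length-++; length-map; filter-++; filter-none; filter-all; filter-accept; map-++; map-∘; map-cong-local;
         drop-map; concatMap-map; map-concatMap; concatMap-cong)
open import Data.List.Membership.Propositional using (_∈_)
open import Data.List.Membership.Propositional.Properties
  using (∈-++⁺ˡ; ∈-++⁺ʳ; ∈-++⁻; ∈-map⁺; ∈-map⁻; ∈-filter⁺; ∈-filter⁻; ∈-upTo⁺; ∈-upTo⁻)
open import Data.List.Membership.Setoid.Properties using (∈-deduplicate⁺; ∈-deduplicate⁻)
open import Data.List.Relation.Binary.Permutation.Propositional using (_↭_; refl; prep; swap; trans; ↭-sym)
import Data.List.Relation.Binary.Permutation.Propositional.Properties as ↭
open import Data.List.Relation.Binary.Subset.Propositional using (_⊆_)
open import Data.List.Relation.Unary.All as All using (All; []; _∷_)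
open import Data.List.Relation.Unary.All.Properties
  using (all-anti-mono; concat⁺; map⁺; filter⁺; deduplicate⁺; drop⁺)
open import Data.List.Relation.Unary.Any using (here; there)
open import Data.List.Relation.Unary.Unique.Propositional using (Unique)
import Data.List.Relation.Unary.Unique.Propositional.Properties as Unique
open import Data.Maybe using (just; nothing)
open import Data.Nat using (ℕ; zero; suc; _+_; _∸_; _≡ᵇ_; _≤_; z≤n; s≤s)
open import Data.Nat.Coprimality as Coprime
  using (Coprime; coprime-+; 1-coprimeTo; 0-coprimeTo-m⇒m≡1; coprime⇒gcd≡1; gcd≡1⇒coprime)
open import Data.Nat.Divisibility using (∣-refl; ∣m∣n⇒∣m+n)
open import Data.Nat.GCD using (gcd)
open import Data.Nat.Properties
  using (+-commutativeSemigroup; +-identityʳ; +-comm; suc-injective; _≟_; ≡ᵇ⇒≡; ≤-refl; ≤-trans; ≤-pred;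
         n≤1+n; <-irrefl; <-asym; <-cmp; <⇒≤; m≤m+n; m<m+n; m<n+m; m<n⇒0<n∸m; m∸n+n≡m; m+[n∸m]≡n;
         m+n∸m≡n; m+n∸n≡m)
open import Data.Product using (Σ; _×_; _,_; proj₁; proj₂)
open import Data.Sum using (inj₁; inj₂)
open import Data.Unit using (tt)
open import Function using (_∘_)
open import Function.Bundles using (_⇔_; mk⇔; Equivalence)
open import Relation.Binary using (tri<; tri≈; tri>)
open import Relation.Binary.PropositionalEquality
  using (_≡_; _≢_; refl; sym; cong; cong₂; subst; module ≡-Reasoning)
  renaming (trans to ≡-trans; setoid to ≡-setoid)
open import Relation.Nullary using (¬_)
open import Relation.Nullary.Decidable using (T?; dec-false; ¬?)

open ≡-Reasoning

-- Counting sublists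

countSubsets : {A : Set} → (List A → Bool) → List A → ℕ
countSubsets P E = length (filterᵇ P (subsets E))

length-filterᵇ-map : {A B : Set} (p : B → Bool) (f : A → B) (xs : List A) →
  length (filterᵇ p (map f xs)) ≡ length (filterᵇ (p ∘ f) xs)
length-filterᵇ-map p f [] = refl
length-filterᵇ-map p f (x ∷ xs) with p (f x)
... | true  = cong suc (length-filterᵇ-map p f xs)
... | false = length-filterᵇ-map p f xs

module _ {A : Set} where

  countSubsets-∷ : (P : List A → Bool) (e : A) (E : List A) →
    countSubsets P (e ∷ E) ≡ countSubsets P E + countSubsets (λ M → P (e ∷ M)) E
  countSubsets-∷ P e E = begin
    length (filterᵇ P (subsets E ++ map (e ∷_) (subsets E)))
      ≡⟨ cong length (filter-++ (T? ∘ P) (subsets E) _) ⟩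
    length (filterᵇ P (subsets E) ++ filterᵇ P (map (e ∷_) (subsets E)))
      ≡⟨ length-++ (filterᵇ P (subsets E)) ⟩
    countSubsets P E + length (filterᵇ P (map (e ∷_) (subsets E)))
      ≡⟨ cong (countSubsets P E +_) (length-filterᵇ-map P (e ∷_) (subsets E)) ⟩
    countSubsets P E + countSubsets (λ M → P (e ∷ M)) E ∎

  countSubsets-cong : {R : A → Set} {P Q : List A → Bool} {E : List A} → All R E →
    (∀ {M} → All R M → P M ≡ Q M) → countSubsets P E ≡ countSubsets Q E
  countSubsets-cong {P = P} {Q} {[]} [] P≡Q with P [] | Q [] | P≡Q []
  ... | true  | .true  | refl = refl
  ... | false | .false | refl = refl
  countSubsets-cong {P = P} {Q} {e ∷ E} (re ∷ rE) P≡Q = begin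
    countSubsets P (e ∷ E)                               ≡⟨ countSubsets-∷ P e E ⟩
    countSubsets P E + countSubsets (λ M → P (e ∷ M)) E  ≡⟨ cong₂ _+_ (countSubsets-cong rE P≡Q)
                                                                     (countSubsets-cong rE (P≡Q ∘ (re ∷_))) ⟩
    countSubsets Q E + countSubsets (λ M → Q (e ∷ M)) E  ≡⟨ sym (countSubsets-∷ Q e E) ⟩
    countSubsets Q (e ∷ E)                               ∎

  countSubsets-≗ : {P Q : List A → Bool} (E : List A) → (∀ M → P M ≡ Q M) →
    countSubsets P E ≡ countSubsets Q E
  countSubsets-≗ E P≗Q = countSubsets-cong (All.universal (λ _ → tt) E) (λ {M} _ → P≗Q M)

  countSubsets-none : {P : List A → Bool} (E : List A) → (∀ M → P M ≡ false) → countSubsets P E ≡ 0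
  countSubsets-none E P≗false =
    cong length (filter-none (T? ∘ _) (All.universal (λ M → subst T (P≗false M)) (subsets E)))

  countSubsets-↭ : {P : List A → Bool} → (∀ {M M′} → M ↭ M′ → P M ≡ P M′) →
    ∀ {E E′} → E ↭ E′ → countSubsets P E ≡ countSubsets P E′
  countSubsets-↭ resp refl = refl
  countSubsets-↭ {P} resp {e ∷ E} {e ∷ E′} (prep e E↭E′) = begin
    countSubsets P (e ∷ E)                                ≡⟨ countSubsets-∷ P e E ⟩
    countSubsets P E + countSubsets (λ M → P (e ∷ M)) E   ≡⟨ cong₂ _+_ (countSubsets-↭ resp E↭E′)
                                                                      (countSubsets-↭ (resp ∘ prep e) E↭E′) ⟩
    countSubsets P E′ + countSubsets (λ M → P (e ∷ M)) E′ ≡⟨ sym (countSubsets-∷ P e E′) ⟩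
    countSubsets P (e ∷ E′)                               ∎
  countSubsets-↭ {P} resp {a ∷ b ∷ E} {b ∷ a ∷ E′} (swap a b E↭E′) = begin
    countSubsets P (a ∷ b ∷ E)
      ≡⟨ ≡-trans (countSubsets-∷ P a (b ∷ E))
                 (cong₂ _+_ (countSubsets-∷ P b E) (countSubsets-∷ (P ∘ (a ∷_)) b E)) ⟩
    (c P E + c (P ∘ (b ∷_)) E) + (c (P ∘ (a ∷_)) E + c (P ∘ (λ M → a ∷ b ∷ M)) E)
      ≡⟨ interchange +-commutativeSemigroup (c P E) (c (P ∘ (b ∷_)) E) (c (P ∘ (a ∷_)) E) _ ⟩
    (c P E + c (P ∘ (a ∷_)) E) + (c (P ∘ (b ∷_)) E + c (P ∘ (λ M → a ∷ b ∷ M)) E)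
      ≡⟨ cong₂ _+_ (cong₂ _+_ (countSubsets-↭ resp E↭E′) (countSubsets-↭ (resp ∘ prep a) E↭E′))
                   (cong₂ _+_ (countSubsets-↭ (resp ∘ prep b) E↭E′) ab≡ba) ⟩
    (c P E′ + c (P ∘ (a ∷_)) E′) + (c (P ∘ (b ∷_)) E′ + c (P ∘ (λ M → b ∷ a ∷ M)) E′)
      ≡⟨ sym (≡-trans (countSubsets-∷ P b (a ∷ E′))
                      (cong₂ _+_ (countSubsets-∷ P a E′) (countSubsets-∷ (P ∘ (b ∷_)) a E′))) ⟩
    countSubsets P (b ∷ a ∷ E′) ∎
    where
    c : (List A → Bool) → List A → ℕ
    c = countSubsets
    ab≡ba : c (P ∘ (λ M → a ∷ b ∷ M)) E ≡ c (P ∘ (λ M → b ∷ a ∷ M)) E′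
    ab≡ba = ≡-trans (countSubsets-↭ (λ M↭M′ → resp (prep a (prep b M↭M′))) E↭E′)
                    (countSubsets-≗ E′ (λ M → resp (swap a b refl)))
  countSubsets-↭ resp (trans E↭E″ E″↭E′) =
    ≡-trans (countSubsets-↭ resp E↭E″) (countSubsets-↭ resp E″↭E′)

-- Degrees and perfect matchings

≡ᵖ-sound : ∀ {p q} → T (p ≡ᵖ q) → p ≡ q
≡ᵖ-sound {a , b} {c , d} t =
  let a≡c , b≡d = Equivalence.to T-∧ t in cong₂ _,_ (≡ᵇ⇒≡ a c a≡c) (≡ᵇ⇒≡ b d b≡d)

≡ᵉ-sound : ∀ {e f} → T (e ≡ᵉ f) → e ≡ f
≡ᵉ-sound t = let p≡r , q≡s = Equivalence.to T-∧ t in cong₂ _,_ (≡ᵖ-sound p≡r) (≡ᵖ-sound q≡s)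

≢⇒≡ᵖ≡false : ∀ {p q} → p ≢ q → (p ≡ᵖ q) ≡ false
≢⇒≡ᵖ≡false {p} {q} p≢q with p ≡ᵖ q in eq
... | true  = ⊥-elim (p≢q (≡ᵖ-sound (subst T (sym eq) tt)))
... | false = refl

incident-≢ : ∀ w {u v} → w ≢ u → w ≢ v → incident w (u , v) ≡ false
incident-≢ w w≢u w≢v rewrite ≢⇒≡ᵖ≡false w≢u | ≢⇒≡ᵖ≡false w≢v = refl

perfectOn : List Point → List Edge → Bool
perfectOn V M = allᵇ (λ v → degreeIn M v ≡ᵇ 1) V

covers avoids : Point → List Edge → Bool
covers w M = degreeIn M w ≡ᵇ 1
avoids w M = degreeIn M w ≡ᵇ 0

Untouched : Point → List Edge → Set
Untouched w = All (λ e → incident w e ≡ false)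

degreeIn-++ : ∀ X M v → degreeIn (X ++ M) v ≡ degreeIn X v + degreeIn M v
degreeIn-++ X M v = ≡-trans (cong length (filter-++ (T? ∘ incident v) X M)) (length-++ (filterᵇ (incident v) X))

degreeIn-↭ : ∀ {M M′} v → M ↭ M′ → degreeIn M v ≡ degreeIn M′ v
degreeIn-↭ v M↭M′ = ↭.↭-length (↭.filter-↭ (T? ∘ incident v) M↭M′)

degreeIn-untouched : ∀ w {M} → Untouched w M → degreeIn M w ≡ 0
degreeIn-untouched w untouched =
  cong length (filter-none (T? ∘ incident w) (All.map (subst T) untouched))

degreeIn-incident : ∀ w a M → incident w a ≡ true → degreeIn (a ∷ M) w ≡ suc (degreeIn M w)
degreeIn-incident w a M touches = cong length (filter-accept (T? ∘ incident w) (subst T (sym touches) tt))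

allᵇ≡all : {A : Set} (p : A → Bool) (xs : List A) → allᵇ p xs ≡ all p xs
allᵇ≡all p [] = refl
allᵇ≡all p (x ∷ xs) = cong (p x ∧_) (allᵇ≡all p xs)

perfectOn-⊆ : ∀ {V V′} M → V ⊆ V′ → V′ ⊆ V → perfectOn V M ≡ perfectOn V′ M
perfectOn-⊆ M V⊆V′ V′⊆V = ⇔→≡ (mk⇔ (anti-mono V′⊆V) (anti-mono V⊆V′))
  where
  anti-mono : ∀ {U U′} → U ⊆ U′ → perfectOn U′ M ≡ true → perfectOn U M ≡ true
  anti-mono {U} {U′} U⊆U′ =
    Equivalence.to T-≡ ∘ subst T (sym (allᵇ≡all _ U)) ∘ all-anti-mono _ U⊆U′
    ∘ subst T (allᵇ≡all _ U′) ∘ Equivalence.from T-≡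

perfectOn-cong : ∀ {V} M M′ → All (λ v → degreeIn M v ≡ degreeIn M′ v) V →
  perfectOn V M ≡ perfectOn V M′
perfectOn-cong M M′ [] = refl
perfectOn-cong M M′ (same ∷ sames) = cong₂ _∧_ (cong (_≡ᵇ 1) same) (perfectOn-cong M M′ sames)

perfectOn-↭ : ∀ V {M M′} → M ↭ M′ → perfectOn V M ≡ perfectOn V M′
perfectOn-↭ V {M} {M′} M↭M′ = perfectOn-cong M M′ (All.universal (λ v → degreeIn-↭ v M↭M′) V)

perfectOn-prefix : ∀ {V} X Y M → All (λ v → degreeIn X v ≡ degreeIn Y v) V →
  perfectOn V (X ++ M) ≡ perfectOn V (Y ++ M)
perfectOn-prefix X Y M = perfectOn-cong (X ++ M) (Y ++ M) ∘ All.map λ {v} same →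
  ≡-trans (degreeIn-++ X M v) (≡-trans (cong (_+ degreeIn M v) same) (sym (degreeIn-++ Y M v)))

perfectOn-miss : ∀ {V} w M → w ∈ V → degreeIn M w ≢ 1 → perfectOn V M ≡ false
perfectOn-miss {_ ∷ V} w M (here refl) miss = cong (_∧ perfectOn V M) (dec-false (degreeIn M w ≟ 1) miss)
perfectOn-miss {v ∷ V} w M (there w∈V) miss =
  ≡-trans (cong (covers v M ∧_) (perfectOn-miss w M w∈V miss)) (∧-zeroʳ (covers v M))

module _ (w : Point) (R : List Edge → Bool) {E : List Edge} (untouched : Untouched w E) where

  countSubsets-covers-untouched : countSubsets (λ M → covers w M ∧ R M) E ≡ 0
  countSubsets-covers-untouched = ≡-trans
    (countSubsets-cong untouched λ {M} u → cong (λ d → (d ≡ᵇ 1) ∧ R M) (degreeIn-untouched w u))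
    (countSubsets-none E (λ _ → refl))

  countSubsets-avoids-untouched : countSubsets (λ M → avoids w M ∧ R M) E ≡ countSubsets R E
  countSubsets-avoids-untouched =
    countSubsets-cong untouched λ {M} u → cong (λ d → (d ≡ᵇ 0) ∧ R M) (degreeIn-untouched w u)

module _ (w : Point) (a : Edge) (R : List Edge → Bool) (touches : incident w a ≡ true)
         {E : List Edge} (untouched : Untouched w E) where

  countSubsets-covers-pendant :
    countSubsets (λ M → covers w M ∧ R M) (a ∷ E) ≡ countSubsets (λ M → R (a ∷ M)) E
  countSubsets-covers-pendant = begin
    countSubsets (λ M → covers w M ∧ R M) (a ∷ E)
      ≡⟨ countSubsets-∷ _ a E ⟩
    countSubsets (λ M → covers w M ∧ R M) E + countSubsets (λ M → covers w (a ∷ M) ∧ R (a ∷ M)) E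
      ≡⟨ cong₂ _+_ (countSubsets-covers-untouched w R untouched)
                   (countSubsets-≗ E λ M →
                      cong (λ d → (d ≡ᵇ 1) ∧ R (a ∷ M)) (degreeIn-incident w a M touches)) ⟩
    countSubsets (λ M → avoids w M ∧ R (a ∷ M)) E
      ≡⟨ countSubsets-avoids-untouched w (λ M → R (a ∷ M)) untouched ⟩
    countSubsets (λ M → R (a ∷ M)) E ∎

  countSubsets-avoids-pendant : countSubsets (λ M → avoids w M ∧ R M) (a ∷ E) ≡ countSubsets R E
  countSubsets-avoids-pendant = begin
    countSubsets (λ M → avoids w M ∧ R M) (a ∷ E)
      ≡⟨ countSubsets-∷ _ a E ⟩
    countSubsets (λ M → avoids w M ∧ R M) E + countSubsets (λ M → avoids w (a ∷ M) ∧ R (a ∷ M)) E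
      ≡⟨ cong₂ _+_ (countSubsets-avoids-untouched w R untouched)
                   (countSubsets-none E λ M →
                      cong (λ d → (d ≡ᵇ 0) ∧ R (a ∷ M)) (degreeIn-incident w a M touches)) ⟩
    countSubsets R E + 0
      ≡⟨ +-identityʳ _ ⟩
    countSubsets R E ∎

perfectOn-dedup : ∀ V M → perfectOn (deduplicateᵇ _≡ᵖ_ V) M ≡ perfectOn V M
perfectOn-dedup V M = perfectOn-⊆ M (∈-deduplicate⁻ (≡-setoid Point) _ V)
  (∈-deduplicate⁺ (≡-setoid Point) _ λ q≡ᵖp r≡p → ≡-trans r≡p (sym (≡ᵖ-sound q≡ᵖp)))

countSubsets-perfectOn-untouched : ∀ {V} w {E} → w ∈ V → Untouched w E → countSubsets (perfectOn V) E ≡ 0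
countSubsets-perfectOn-untouched w {E} w∈V untouched = ≡-trans
  (countSubsets-cong untouched λ {M} u →
     perfectOn-miss w M w∈V λ d≡1 → 0≢1 (≡-trans (sym (degreeIn-untouched w u)) d≡1))
  (countSubsets-none E (λ _ → refl))
  where
  0≢1 : 0 ≢ 1
  0≢1 ()

-- Snake geometry

origin : Point
origin = (0 , 0)

move : Dir → Point → Point
move North (x , y) = (x , suc y)
move East  (x , y) = (suc x , y)

moveEdge : Dir → Edge → Edge
moveEdge d (p , q) = (move d p , move d q)

turn : Dir → Dir
turn North = East
turn East  = North

south north west east : Point → Edge
south (x , y) = ((x , y) , (suc x , y))
north (x , y) = ((x , suc y) , (suc x , suc y))
west  (x , y) = ((x , y) , (x , suc y))
east  (x , y) = ((suc x , y) , (suc x , suc y))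

snakeVertices : Point → List Dir → List Point
snakeVertices p ds = concatMap tileVertices (corners p ds)

snakeEdges : Point → List Dir → List Edge
snakeEdges p ds = deduplicateᵇ _≡ᵉ_ (concatMap tileEdges (corners p ds))

removeAll : List Edge → List Edge → List Edge
removeAll X L = foldr (λ e → filter (λ f → ¬? (T? (e ≡ᵉ f)))) L X

-- Shaped like the tail that deduplicateᵇ leaves behind the first tile, so that snakeEdges
-- unfolds to tileEdges p ++ laterEdges p ds by computation at concrete points.
laterEdges : Point → List Dir → List Edge
laterEdges p []       = []
laterEdges p (d ∷ ds) = removeAll (tileEdges p) (snakeEdges (move d p) ds)

Above : Point → Point → Set
Above (x , y) (a , b) = x ≤ a × y ≤ b

AboveE : Point → Edge → Set
AboveE p (u , v) = Above p u × Above p v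

Beyond : Point → Edge → Set
Beyond p e = AboveE p e × incident p e ≡ false

Above-refl : ∀ p → Above p p
Above-refl p = ≤-refl , ≤-refl

Above-trans : ∀ {p q r} → Above p q → Above q r → Above p r
Above-trans (x≤a , y≤b) (a≤c , b≤d) = ≤-trans x≤a a≤c , ≤-trans y≤b b≤d

Above-move : ∀ d p → Above p (move d p)
Above-move North (x , y) = ≤-refl , n≤1+n y
Above-move East  (x , y) = n≤1+n x , ≤-refl

move-¬Above : ∀ d p → ¬ Above (move d p) p
move-¬Above North p (_ , y<y) = <-irrefl refl y<y
move-¬Above East  p (x<x , _) = <-irrefl refl x<x

AboveE-trans : ∀ {p q} e → Above p q → AboveE q e → AboveE p e
AboveE-trans (u , v) p≤q (q≤u , q≤v) = Above-trans p≤q q≤u , Above-trans p≤q q≤v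

below-untouched : ∀ {p} w → ¬ Above p w → ∀ {E} → All (AboveE p) E → Untouched w E
below-untouched w ¬p≤w = All.map λ { {u , v} (p≤u , p≤v) →
  incident-≢ w (λ { refl → ¬p≤w p≤u }) (λ { refl → ¬p≤w p≤v }) }

AboveE-move⇒Beyond : ∀ d p e → AboveE (move d p) e → Beyond p e
AboveE-move⇒Beyond d p (u , v) above@(q≤u , q≤v) =
  AboveE-trans (u , v) (Above-move d p) above ,
  incident-≢ p (λ { refl → move-¬Above d p q≤u }) (λ { refl → move-¬Above d p q≤v })

tileVertices-above : ∀ p → All (Above p) (tileVertices p)
tileVertices-above (x , y) =
  (≤-refl , ≤-refl) ∷ (n≤1+n x , ≤-refl) ∷ (≤-refl , n≤1+n y) ∷ (n≤1+n x , n≤1+n y) ∷ []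

tileEdges-above : ∀ p → All (AboveE p) (tileEdges p)
tileEdges-above p with tileVertices-above p
... | sw ∷ se ∷ nw ∷ ne ∷ [] = (sw , se) ∷ (nw , ne) ∷ (sw , nw) ∷ (se , ne) ∷ []

corners-above : ∀ p ds → All (Above p) (corners p ds)
corners-above p [] = Above-refl p ∷ []
corners-above p (North ∷ ds) =
  Above-refl p ∷ All.map (Above-trans (Above-move North p)) (corners-above (move North p) ds)
corners-above p (East ∷ ds) =
  Above-refl p ∷ All.map (Above-trans (Above-move East p)) (corners-above (move East p) ds)

snakeVertices-above : ∀ p ds → All (Above p) (snakeVertices p ds)
snakeVertices-above p ds =
  concat⁺ (map⁺ (All.map (λ p≤c → All.map (Above-trans p≤c) (tileVertices-above _)) (corners-above p ds)))

snakeEdges-above : ∀ p ds → All (AboveE p) (snakeEdges p ds)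
snakeEdges-above p ds = deduplicate⁺ _ (concat⁺ (map⁺
  (All.map (λ p≤c → All.map (λ {e} → AboveE-trans e p≤c) (tileEdges-above _)) (corners-above p ds))))

removeAll⁺ : ∀ {P : Edge → Set} X {L} → All P L → All P (removeAll X L)
removeAll⁺ []      ps = ps
removeAll⁺ (x ∷ X) ps = filter⁺ _ (removeAll⁺ X ps)

laterEdges-beyond : ∀ p ds → All (Beyond p) (laterEdges p ds)
laterEdges-beyond p [] = []
laterEdges-beyond p (d ∷ ds) =
  removeAll⁺ (tileEdges p) (All.map (AboveE-move⇒Beyond d p _) (snakeEdges-above (move d p) ds))

removeAll-beyond : ∀ {q} X {L} → All (λ x → ¬ Beyond q x) X → All (Beyond q) L → removeAll X L ≡ L
removeAll-beyond []      []            _      = refl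
removeAll-beyond (x ∷ X) (x∉ ∷ X∉) beyond rewrite removeAll-beyond X X∉ beyond =
  filter-all _ (All.map (λ beyond-f x≡f → x∉ (subst (Beyond _) (sym (≡ᵉ-sound x≡f)) beyond-f)) beyond)

snakeEdges-head : ∀ p ds → snakeEdges p ds ≡ south p ∷ drop 1 (snakeEdges p ds)
snakeEdges-head p []           = refl
snakeEdges-head p (North ∷ ds) = refl
snakeEdges-head p (East ∷ ds)  = refl

snakeEdges-neighbour : ∀ d ds →
  snakeEdges (move d origin) ds ≡ tileEdges (move d origin) ++ laterEdges (move d origin) ds
snakeEdges-neighbour North []           = refl
snakeEdges-neighbour North (North ∷ ds) = refl
snakeEdges-neighbour North (East ∷ ds)  = refl
snakeEdges-neighbour East  []           = refl
snakeEdges-neighbour East  (North ∷ ds) = refl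
snakeEdges-neighbour East  (East ∷ ds)  = refl

tileEdges-origin-¬Beyond : ∀ d → All (λ x → ¬ Beyond (move d origin) x) (tileEdges origin)
tileEdges-origin-¬Beyond North =
  (λ { (((_ , ()) , _) , _) }) ∷ (λ { (_ , ()) }) ∷
  (λ { (((_ , ()) , _) , _) }) ∷ (λ { (((_ , ()) , _) , _) }) ∷ []
tileEdges-origin-¬Beyond East =
  (λ { (((() , _) , _) , _) }) ∷ (λ { (((() , _) , _) , _) }) ∷
  (λ { (((() , _) , _) , _) }) ∷ (λ { (_ , ()) }) ∷ []

removeAll-origin-laterEdges : ∀ d ds →
  removeAll (tileEdges origin) (laterEdges (move d origin) ds) ≡ laterEdges (move d origin) ds
removeAll-origin-laterEdges d ds =
  removeAll-beyond (tileEdges origin) (tileEdges-origin-¬Beyond d) (laterEdges-beyond (move d origin) ds)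

-- In the first step removeAll (tileEdges origin) drops the shared edge by computation.
snakeEdges-North : ∀ ds →
  snakeEdges origin (North ∷ ds) ≡ tileEdges origin ++ drop 1 (snakeEdges (move North origin) ds)
snakeEdges-North ds = begin
  tileEdges origin ++ removeAll (tileEdges origin) (snakeEdges n ds)
    ≡⟨ cong (λ E → tileEdges origin ++ removeAll (tileEdges origin) E) (snakeEdges-neighbour North ds) ⟩
  tileEdges origin ++ north n ∷ west n ∷ east n ∷ removeAll (tileEdges origin) (laterEdges n ds)
    ≡⟨ cong (λ L → tileEdges origin ++ north n ∷ west n ∷ east n ∷ L)
            (removeAll-origin-laterEdges North ds) ⟩
  tileEdges origin ++ drop 1 (tileEdges n ++ laterEdges n ds)
    ≡⟨ cong (λ E → tileEdges origin ++ drop 1 E) (sym (snakeEdges-neighbour North ds)) ⟩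
  tileEdges origin ++ drop 1 (snakeEdges n ds) ∎
  where
  n : Point
  n = move North origin

snakeEdges-East : ∀ ds → let e = move East origin in
  snakeEdges origin (East ∷ ds) ≡ tileEdges origin ++ south e ∷ north e ∷ east e ∷ laterEdges e ds
snakeEdges-East ds = begin
  tileEdges origin ++ removeAll (tileEdges origin) (snakeEdges e ds)
    ≡⟨ cong (λ E → tileEdges origin ++ removeAll (tileEdges origin) E) (snakeEdges-neighbour East ds) ⟩
  tileEdges origin ++ south e ∷ north e ∷ east e ∷ removeAll (tileEdges origin) (laterEdges e ds)
    ≡⟨ cong (λ L → tileEdges origin ++ south e ∷ north e ∷ east e ∷ L)
            (removeAll-origin-laterEdges East ds) ⟩
  tileEdges origin ++ south e ∷ north e ∷ east e ∷ laterEdges e ds ∎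
  where
  e : Point
  e = move East origin

snakeVertices-∷ : ∀ p d ds → snakeVertices p (d ∷ ds) ≡ tileVertices p ++ snakeVertices (move d p) ds
snakeVertices-∷ p North ds = refl
snakeVertices-∷ p East  ds = refl

tileVertices⊆snakeVertices : ∀ p ds → tileVertices p ⊆ snakeVertices p ds
tileVertices⊆snakeVertices p []           = ∈-++⁺ˡ
tileVertices⊆snakeVertices p (North ∷ ds) = ∈-++⁺ˡ
tileVertices⊆snakeVertices p (East ∷ ds)  = ∈-++⁺ˡ

tileVertices-origin-⊆ : ∀ d →
  tileVertices origin ⊆ origin ∷ move (turn d) origin ∷ tileVertices (move d origin)
tileVertices-origin-⊆ North (here refl)                         = here refl
tileVertices-origin-⊆ North (there (here refl))                 = there (here refl)
tileVertices-origin-⊆ North (there (there (here refl)))         = there (there (here refl))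
tileVertices-origin-⊆ North (there (there (there (here refl)))) = there (there (there (here refl)))
tileVertices-origin-⊆ East  (here refl)                         = here refl
tileVertices-origin-⊆ East  (there (here refl))                 = there (there (here refl))
tileVertices-origin-⊆ East  (there (there (here refl)))         = there (here refl)
tileVertices-origin-⊆ East  (there (there (there (here refl)))) = there (there (there (there (here refl))))

turn-∈-tileVertices : ∀ d → move (turn d) origin ∈ tileVertices origin
turn-∈-tileVertices North = there (here refl)
turn-∈-tileVertices East  = there (there (here refl))

-- Of the four corners of the first tile, two are corners of the second tile.
perfectOn-snake-∷ : ∀ d ds M → perfectOn (snakeVertices origin (d ∷ ds)) M ≡
  covers origin M ∧ (covers (move (turn d) origin) M ∧ perfectOn (snakeVertices (move d origin) ds) M)
perfectOn-snake-∷ d ds M =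
  ≡-trans (cong (λ V → perfectOn V M) (snakeVertices-∷ origin d ds)) (perfectOn-⊆ M split unsplit)
  where
  V′ : List Point
  V′ = snakeVertices (move d origin) ds

  split : tileVertices origin ++ V′ ⊆ origin ∷ move (turn d) origin ∷ V′
  split v∈ with ∈-++⁻ (tileVertices origin) v∈
  ... | inj₂ v∈V′ = there (there v∈V′)
  ... | inj₁ v∈tile with tileVertices-origin-⊆ d v∈tile
  ...   | here v≡o             = here v≡o
  ...   | there (here v≡t)     = there (here v≡t)
  ...   | there (there v∈next) = there (there (tileVertices⊆snakeVertices (move d origin) ds v∈next))

  unsplit : origin ∷ move (turn d) origin ∷ V′ ⊆ tileVertices origin ++ V′
  unsplit (here refl)         = here refl
  unsplit (there (here refl)) = ∈-++⁺ˡ (turn-∈-tileVertices d)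
  unsplit (there (there v∈))  = ∈-++⁺ʳ (tileVertices origin) v∈

outside-untouched : ∀ {p u w} → ¬ Above p u → ¬ Above p w → ∀ {V} → All (Above p) V →
  All (λ v → degreeIn ((u , w) ∷ []) v ≡ degreeIn [] v) V
outside-untouched ¬p≤u ¬p≤w = All.map λ {v} p≤v →
  degreeIn-untouched v (incident-≢ v (λ { refl → ¬p≤u p≤v }) (λ { refl → ¬p≤w p≤v }) ∷ [])

-- Translating a snake

move-comm : ∀ d d′ p → move d′ (move d p) ≡ move d (move d′ p)
move-comm North North p = refl
move-comm North East  p = refl
move-comm East  North p = refl
move-comm East  East  p = refl

corners-move : ∀ d p ds → corners (move d p) ds ≡ map (move d) (corners p ds)
corners-move d p []           = refl
corners-move d p (North ∷ ds) = cong (move d p ∷_)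
  (≡-trans (cong (λ q → corners q ds) (move-comm d North p)) (corners-move d (move North p) ds))
corners-move d p (East ∷ ds)  = cong (move d p ∷_)
  (≡-trans (cong (λ q → corners q ds) (move-comm d East p)) (corners-move d (move East p) ds))

tileVertices-move : ∀ d p → tileVertices (move d p) ≡ map (move d) (tileVertices p)
tileVertices-move North p = refl
tileVertices-move East  p = refl

tileEdges-move : ∀ d p → tileEdges (move d p) ≡ map (moveEdge d) (tileEdges p)
tileEdges-move North p = refl
tileEdges-move East  p = refl

concatMap-move : {A : Set} {d : Dir} (f : Point → List A) (g : A → A) →
  (∀ p → f (move d p) ≡ map g (f p)) → ∀ ps →
  concatMap f (map (move d) ps) ≡ map g (concatMap f ps)
concatMap-move f g f-move ps =
  ≡-trans (concatMap-map f _ ps) (≡-trans (concatMap-cong f-move ps) (sym (map-concatMap g f ps)))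

deduplicateᵇ-map : {A : Set} (r : A → A → Bool) (h : A → A) → (∀ x y → r (h x) (h y) ≡ r x y) →
  ∀ xs → deduplicateᵇ r (map h xs) ≡ map h (deduplicateᵇ r xs)
deduplicateᵇ-map r h r-h [] = refl
deduplicateᵇ-map r h r-h (x ∷ xs) =
  cong (h x ∷_) (≡-trans (cong (filter _) (deduplicateᵇ-map r h r-h xs)) (filter-map (deduplicateᵇ r xs)))
  where
  filter-map : ∀ ys →
    filter (λ y → ¬? (T? (r (h x) y))) (map h ys) ≡ map h (filter (λ y → ¬? (T? (r x y))) ys)
  filter-map [] = refl
  filter-map (y ∷ ys) rewrite r-h x y with r x y
  ... | true  = filter-map ys
  ... | false = cong (h y ∷_) (filter-map ys)

snakeVertices-move : ∀ d p ds → snakeVertices (move d p) ds ≡ map (move d) (snakeVertices p ds)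
snakeVertices-move d p ds =
  ≡-trans (cong (concatMap tileVertices) (corners-move d p ds))
          (concatMap-move tileVertices (move d) (tileVertices-move d) (corners p ds))

snakeEdges-move : ∀ d p ds → snakeEdges (move d p) ds ≡ map (moveEdge d) (snakeEdges p ds)
snakeEdges-move d p ds = begin
  deduplicateᵇ _≡ᵉ_ (concatMap tileEdges (corners (move d p) ds))
    ≡⟨ cong (deduplicateᵇ _≡ᵉ_ ∘ concatMap tileEdges) (corners-move d p ds) ⟩
  deduplicateᵇ _≡ᵉ_ (concatMap tileEdges (map (move d) (corners p ds)))
    ≡⟨ cong (deduplicateᵇ _≡ᵉ_) (concatMap-move tileEdges (moveEdge d) (tileEdges-move d) (corners p ds)) ⟩
  deduplicateᵇ _≡ᵉ_ (map (moveEdge d) (concatMap tileEdges (corners p ds)))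
    ≡⟨ deduplicateᵇ-map _≡ᵉ_ (moveEdge d) (≡ᵉ-moveEdge d) _ ⟩
  map (moveEdge d) (snakeEdges p ds) ∎
  where
  ≡ᵉ-moveEdge : ∀ d e f → (moveEdge d e ≡ᵉ moveEdge d f) ≡ (e ≡ᵉ f)
  ≡ᵉ-moveEdge North e f = refl
  ≡ᵉ-moveEdge East  e f = refl

subsets-map : {A B : Set} (h : A → B) (E : List A) → subsets (map h E) ≡ map (map h) (subsets E)
subsets-map h [] = refl
subsets-map {A} h (x ∷ E) = begin
  subsets (map h E) ++ map (h x ∷_) (subsets (map h E))
    ≡⟨ cong (λ S → S ++ map (h x ∷_) S) (subsets-map h E) ⟩
  map (map h) S ++ map (h x ∷_) (map (map h) S)
    ≡⟨ cong (map (map h) S ++_) (≡-trans (sym (map-∘ S)) (map-∘ S)) ⟩ -- both are map (λ M → h x ∷ map h M) S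
  map (map h) S ++ map (map h) (map (x ∷_) S)
    ≡⟨ sym (map-++ (map h) S _) ⟩
  map (map h) (subsets (x ∷ E)) ∎
  where
  S : List (List A)
  S = subsets E

countSubsets-map : {A B : Set} (P : List B → Bool) (h : A → B) (E : List A) →
  countSubsets P (map h E) ≡ countSubsets (λ M → P (map h M)) E
countSubsets-map P h E =
  ≡-trans (cong (length ∘ filterᵇ P) (subsets-map h E)) (length-filterᵇ-map P (map h) (subsets E))

perfectOn-move : ∀ d V M → perfectOn (map (move d) V) (map (moveEdge d) M) ≡ perfectOn V M
perfectOn-move d [] M = refl
perfectOn-move d (v ∷ V) M = cong₂ _∧_ (cong (_≡ᵇ 1) (degreeIn-move d)) (perfectOn-move d V M)
  where
  -- Once d is known, incident (move d v) (moveEdge d e) computes to incident v e.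
  degreeIn-move : ∀ d → degreeIn (map (moveEdge d) M) (move d v) ≡ degreeIn M v
  degreeIn-move North = length-filterᵇ-map (incident (move North v)) (moveEdge North) M
  degreeIn-move East  = length-filterᵇ-map (incident (move East v)) (moveEdge East) M

-- Removing the first tile

-- The number of M, not containing the south edge of the first tile, such that X ++ M is a
-- perfect matching of the snake at p.
extensions : Point → List Dir → List Edge → ℕ
extensions p ds X = countSubsets (λ M → perfectOn (snakeVertices p ds) (X ++ M)) (drop 1 (snakeEdges p ds))

extensions-move : ∀ d p ds X → extensions (move d p) ds (map (moveEdge d) X) ≡ extensions p ds X
extensions-move d p ds X = begin
  countSubsets (λ M → perfectOn (snakeVertices (move d p) ds) (X′ ++ M)) (drop 1 (snakeEdges (move d p) ds))
    ≡⟨ cong₂ (λ U F → countSubsets (λ M → perfectOn U (X′ ++ M)) (drop 1 F))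
             (snakeVertices-move d p ds) (snakeEdges-move d p ds) ⟩
  countSubsets (λ M → perfectOn V′ (X′ ++ M)) (drop 1 (map (moveEdge d) E))
    ≡⟨ cong (countSubsets _) (drop-map 1 E) ⟩
  countSubsets (λ M → perfectOn V′ (X′ ++ M)) (map (moveEdge d) (drop 1 E))
    ≡⟨ countSubsets-map _ (moveEdge d) (drop 1 E) ⟩
  countSubsets (λ M → perfectOn V′ (X′ ++ map (moveEdge d) M)) (drop 1 E)
    ≡⟨ countSubsets-≗ (drop 1 E) (λ M →
         ≡-trans (cong (perfectOn V′) (sym (map-++ (moveEdge d) X M))) (perfectOn-move d V (X ++ M))) ⟩
  countSubsets (λ M → perfectOn V (X ++ M)) (drop 1 E) ∎
  where
  V V′ : List Point
  V = snakeVertices p ds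
  V′ = map (move d) V
  E X′ : List Edge
  E = snakeEdges p ds
  X′ = map (moveEdge d) X

countSubsets-snake : ∀ p ds → countSubsets (perfectOn (snakeVertices p ds)) (snakeEdges p ds) ≡
  extensions p ds [] + extensions p ds (south p ∷ [])
countSubsets-snake p ds =
  ≡-trans (cong (countSubsets _) (snakeEdges-head p ds))
          (countSubsets-∷ (perfectOn (snakeVertices p ds)) (south p) (drop 1 (snakeEdges p ds)))

extensions-∷ : ∀ d ds X → extensions origin (d ∷ ds) X ≡
  countSubsets (λ M → covers origin (X ++ M) ∧ (covers (move (turn d) origin) (X ++ M) ∧
                      perfectOn (snakeVertices (move d origin) ds) (X ++ M)))
               (drop 1 (snakeEdges origin (d ∷ ds)))
extensions-∷ d ds X =
  countSubsets-≗ (drop 1 (snakeEdges origin (d ∷ ds))) (λ M → perfectOn-snake-∷ d ds (X ++ M))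

north-rung : ∀ v → Above (move North origin) v →
  degreeIn (west origin ∷ east origin ∷ []) v ≡ degreeIn (north origin ∷ []) v
north-rung (a , zero) (_ , ())
north-rung (zero , suc zero) _ = refl
north-rung (zero , suc (suc b)) _ = refl
north-rung (suc zero , suc zero) _ = refl
north-rung (suc zero , suc (suc b)) _ = refl
north-rung (suc (suc a) , suc zero) _ = refl
north-rung (suc (suc a) , suc (suc b)) _ = refl

east-rung : ∀ v → Above (move East origin) v →
  degreeIn (south origin ∷ north origin ∷ []) v ≡ degreeIn (east origin ∷ []) v
east-rung (zero , b) (() , _)
east-rung (suc zero , zero) _ = refl
east-rung (suc zero , suc zero) _ = refl
east-rung (suc zero , suc (suc b)) _ = refl
east-rung (suc (suc a) , zero) _ = refl
east-rung (suc (suc a) , suc zero) _ = refl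
east-rung (suc (suc a) , suc (suc b)) _ = refl

module NorthStep (ds : List Dir) where

  private
    n e : Point
    n = move North origin
    e = move East origin

    S₀ N₀ W₀ E₀ : Edge
    S₀ = south origin
    N₀ = north origin
    W₀ = west origin
    E₀ = east origin

    Q : List Edge → Bool
    Q = perfectOn (snakeVertices n ds)

    K : List Edge
    K = drop 1 (snakeEdges n ds)

    remaining-edges : drop 1 (snakeEdges origin (North ∷ ds)) ≡ N₀ ∷ W₀ ∷ E₀ ∷ K
    remaining-edges = cong (drop 1) (snakeEdges-North ds)

    K-above : All (AboveE n) K
    K-above = drop⁺ 1 (snakeEdges-above n ds)

    vertices-above : All (Above n) (snakeVertices n ds)
    vertices-above = snakeVertices-above n ds

    origin-untouched : Untouched origin (E₀ ∷ K)
    origin-untouched = refl ∷ below-untouched origin (λ ()) K-above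

    e-untouched : Untouched e K
    e-untouched = below-untouched e (λ ()) K-above

    rungs : ∀ M → Q (W₀ ∷ E₀ ∷ M) ≡ Q (N₀ ∷ M)
    rungs M = perfectOn-prefix (W₀ ∷ E₀ ∷ []) (N₀ ∷ []) M (All.map (north-rung _) vertices-above)

    south-unseen : ∀ M → Q (S₀ ∷ M) ≡ Q M
    south-unseen M = perfectOn-prefix (S₀ ∷ []) [] M (outside-untouched (λ ()) (λ ()) vertices-above)

    n-doubled : ∀ M → Q (N₀ ∷ W₀ ∷ E₀ ∷ M) ≡ false
    n-doubled M = perfectOn-miss n (N₀ ∷ W₀ ∷ E₀ ∷ M) (tileVertices⊆snakeVertices n ds (here refl)) λ ()

    covering : ∀ (R : List Edge → Bool) →
      countSubsets (λ M → covers origin M ∧ (covers e M ∧ R M)) (W₀ ∷ E₀ ∷ K) ≡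
      countSubsets (λ M → R (W₀ ∷ E₀ ∷ M)) K
    covering R = ≡-trans
      (countSubsets-covers-pendant origin W₀ (λ M → covers e M ∧ R M) refl origin-untouched)
      (countSubsets-covers-pendant e E₀ (λ M → R (W₀ ∷ M)) refl e-untouched)

    avoiding : ∀ (R : List Edge → Bool) →
      countSubsets (λ M → avoids origin M ∧ (avoids e M ∧ R M)) (W₀ ∷ E₀ ∷ K) ≡ countSubsets R K
    avoiding R = ≡-trans
      (countSubsets-avoids-pendant origin W₀ (λ M → avoids e M ∧ R M) refl origin-untouched)
      (countSubsets-avoids-pendant e E₀ R refl e-untouched)

  extensions-North-avoiding : extensions origin (North ∷ ds) [] ≡ extensions origin ds (south origin ∷ [])
  extensions-North-avoiding = begin
    extensions origin (North ∷ ds) []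
      ≡⟨ ≡-trans (extensions-∷ North ds []) (cong (countSubsets P) remaining-edges) ⟩
    countSubsets P (N₀ ∷ W₀ ∷ E₀ ∷ K)
      ≡⟨ countSubsets-∷ P N₀ (W₀ ∷ E₀ ∷ K) ⟩
    countSubsets P (W₀ ∷ E₀ ∷ K) + countSubsets (λ M → P (N₀ ∷ M)) (W₀ ∷ E₀ ∷ K)
      ≡⟨ cong₂ _+_ (covering Q) (covering (λ M → Q (N₀ ∷ M))) ⟩
    countSubsets (λ M → Q (W₀ ∷ E₀ ∷ M)) K + countSubsets (λ M → Q (N₀ ∷ W₀ ∷ E₀ ∷ M)) K
      ≡⟨ cong₂ _+_ (countSubsets-≗ K rungs) (countSubsets-none K n-doubled) ⟩
    extensions n ds (N₀ ∷ []) + 0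
      ≡⟨ ≡-trans (+-identityʳ _) (extensions-move North origin ds (S₀ ∷ [])) ⟩
    extensions origin ds (S₀ ∷ []) ∎
    where
    P : List Edge → Bool
    P M = covers origin M ∧ (covers e M ∧ Q M)

  extensions-North-using : extensions origin (North ∷ ds) (south origin ∷ []) ≡
                           extensions origin ds [] + extensions origin ds (south origin ∷ [])
  extensions-North-using = begin
    extensions origin (North ∷ ds) (S₀ ∷ [])
      ≡⟨ ≡-trans (extensions-∷ North ds (S₀ ∷ [])) (cong (countSubsets P) remaining-edges) ⟩
    countSubsets P (N₀ ∷ W₀ ∷ E₀ ∷ K)
      ≡⟨ countSubsets-∷ P N₀ (W₀ ∷ E₀ ∷ K) ⟩
    countSubsets P (W₀ ∷ E₀ ∷ K) + countSubsets (λ M → P (N₀ ∷ M)) (W₀ ∷ E₀ ∷ K)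
      ≡⟨ cong₂ _+_ (avoiding (λ M → Q (S₀ ∷ M))) (avoiding (λ M → Q (S₀ ∷ N₀ ∷ M))) ⟩
    countSubsets (λ M → Q (S₀ ∷ M)) K + countSubsets (λ M → Q (S₀ ∷ N₀ ∷ M)) K
      ≡⟨ cong₂ _+_ (countSubsets-≗ K south-unseen) (countSubsets-≗ K (south-unseen ∘ (N₀ ∷_))) ⟩
    extensions n ds [] + extensions n ds (N₀ ∷ [])
      ≡⟨ cong₂ _+_ (extensions-move North origin ds []) (extensions-move North origin ds (S₀ ∷ [])) ⟩
    extensions origin ds [] + extensions origin ds (S₀ ∷ []) ∎
    where
    P : List Edge → Bool
    P M = covers origin (S₀ ∷ M) ∧ (covers e (S₀ ∷ M) ∧ Q (S₀ ∷ M))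

module EastStep (ds : List Dir) where

  private
    n e : Point
    n = move North origin
    e = move East origin

    S₀ N₀ W₀ E₀ : Edge
    S₀ = south origin
    N₀ = north origin
    W₀ = west origin
    E₀ = east origin

    V′ : List Point
    V′ = snakeVertices e ds

    Q : List Edge → Bool
    Q = perfectOn V′

    J K : List Edge
    J = north e ∷ east e ∷ laterEdges e ds
    K = south e ∷ J

    remaining-edges : drop 1 (snakeEdges origin (East ∷ ds)) ≡ N₀ ∷ W₀ ∷ E₀ ∷ K
    remaining-edges = cong (drop 1) (snakeEdges-East ds)

    -- E₀ is the west edge of the second tile.
    shared-edge-first : E₀ ∷ K ↭ snakeEdges e ds
    shared-edge-first = subst (E₀ ∷ K ↭_) (sym (snakeEdges-neighbour East ds))
                              (↭-sym (↭.shift E₀ (south e ∷ north e ∷ []) (east e ∷ laterEdges e ds)))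

    EK-above : All (AboveE e) (E₀ ∷ K)
    EK-above = ↭.All-resp-↭ (↭-sym shared-edge-first) (snakeEdges-above e ds)

    origin-EK : Untouched origin (E₀ ∷ K)
    origin-EK = below-untouched origin (λ ()) EK-above

    n-EK : Untouched n (E₀ ∷ K)
    n-EK = below-untouched n (λ ()) EK-above

    e∈V′ : e ∈ V′
    e∈V′ = tileVertices⊆snakeVertices e ds (here refl)

    vertices-above : All (Above e) V′
    vertices-above = snakeVertices-above e ds

    rungs : ∀ M → Q (S₀ ∷ N₀ ∷ M) ≡ Q (E₀ ∷ M)
    rungs M = perfectOn-prefix (S₀ ∷ N₀ ∷ []) (E₀ ∷ []) M (All.map (east-rung _) vertices-above)

    west-unseen : ∀ M → Q (W₀ ∷ M) ≡ Q M
    west-unseen M = perfectOn-prefix (W₀ ∷ []) [] M (outside-untouched (λ ()) (λ ()) vertices-above)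

    e-doubled : ∀ M → Q (E₀ ∷ E₀ ∷ M) ≡ false
    e-doubled M = perfectOn-miss e (E₀ ∷ E₀ ∷ M) e∈V′ λ ()

    e-doubled′ : ∀ M → Q (E₀ ∷ south e ∷ M) ≡ false
    e-doubled′ M = perfectOn-miss e (E₀ ∷ south e ∷ M) e∈V′ λ ()

    -- The south-west corner of the second tile is covered by its south or by its west edge.
    extensions-west : extensions e ds [] ≡ countSubsets (λ M → Q (E₀ ∷ M)) J
    extensions-west = begin
      countSubsets Q (drop 1 (snakeEdges e ds))
        ≡⟨ cong (countSubsets Q ∘ drop 1) (snakeEdges-neighbour East ds) ⟩
      countSubsets Q (north e ∷ E₀ ∷ east e ∷ laterEdges e ds)
        ≡⟨ countSubsets-↭ (perfectOn-↭ V′) (swap (north e) E₀ (refl {xs = east e ∷ laterEdges e ds})) ⟩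
      countSubsets Q (E₀ ∷ J)
        ≡⟨ countSubsets-∷ Q E₀ J ⟩
      countSubsets Q J + countSubsets (λ M → Q (E₀ ∷ M)) J
        ≡⟨ cong (_+ countSubsets (λ M → Q (E₀ ∷ M)) J) (countSubsets-perfectOn-untouched e e∈V′ e-J) ⟩
      countSubsets (λ M → Q (E₀ ∷ M)) J ∎
      where
      e-J : Untouched e J
      e-J = refl ∷ refl ∷ All.map proj₂ (laterEdges-beyond e ds)

  extensions-East-avoiding : extensions origin (East ∷ ds) [] ≡
                             extensions origin ds [] + extensions origin ds (south origin ∷ [])
  extensions-East-avoiding = begin
    extensions origin (East ∷ ds) []
      ≡⟨ ≡-trans (extensions-∷ East ds []) (cong (countSubsets P) remaining-edges) ⟩
    countSubsets P (N₀ ∷ W₀ ∷ E₀ ∷ K)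
      ≡⟨ countSubsets-∷ P N₀ (W₀ ∷ E₀ ∷ K) ⟩
    countSubsets P (W₀ ∷ E₀ ∷ K) + countSubsets (λ M → P (N₀ ∷ M)) (W₀ ∷ E₀ ∷ K)
      ≡⟨ cong₂ _+_ (countSubsets-covers-pendant origin W₀ (λ M → covers n M ∧ Q M) refl origin-EK)
                   (countSubsets-covers-pendant origin W₀ (λ M → avoids n M ∧ Q (N₀ ∷ M)) refl origin-EK) ⟩
    countSubsets (λ M → avoids n M ∧ Q (W₀ ∷ M)) (E₀ ∷ K) + countSubsets (λ (_ : List Edge) → false) (E₀ ∷ K)
      ≡⟨ cong₂ _+_ (countSubsets-avoids-untouched n (λ M → Q (W₀ ∷ M)) n-EK)
                   (countSubsets-none (E₀ ∷ K) λ _ → refl) ⟩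
    countSubsets (λ M → Q (W₀ ∷ M)) (E₀ ∷ K) + 0
      ≡⟨ ≡-trans (+-identityʳ _) (countSubsets-≗ (E₀ ∷ K) west-unseen) ⟩
    countSubsets Q (E₀ ∷ K)
      ≡⟨ countSubsets-↭ (perfectOn-↭ V′) shared-edge-first ⟩
    countSubsets Q (snakeEdges e ds)
      ≡⟨ countSubsets-snake e ds ⟩
    extensions e ds [] + extensions e ds (south e ∷ [])
      ≡⟨ cong₂ _+_ (extensions-move East origin ds []) (extensions-move East origin ds (S₀ ∷ [])) ⟩
    extensions origin ds [] + extensions origin ds (S₀ ∷ []) ∎
    where
    P : List Edge → Bool
    P M = covers origin M ∧ (covers n M ∧ Q M)

  extensions-East-using : extensions origin (East ∷ ds) (south origin ∷ []) ≡ extensions origin ds []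
  extensions-East-using = begin
    extensions origin (East ∷ ds) (S₀ ∷ [])
      ≡⟨ ≡-trans (extensions-∷ East ds (S₀ ∷ [])) (cong (countSubsets P) remaining-edges) ⟩
    countSubsets P (N₀ ∷ W₀ ∷ E₀ ∷ K)
      ≡⟨ countSubsets-∷ P N₀ (W₀ ∷ E₀ ∷ K) ⟩
    countSubsets P (W₀ ∷ E₀ ∷ K) + countSubsets (λ M → P (N₀ ∷ M)) (W₀ ∷ E₀ ∷ K)
      ≡⟨ cong₂ _+_ (countSubsets-avoids-pendant origin W₀ (λ M → covers n M ∧ Q (S₀ ∷ M)) refl origin-EK)
                   (countSubsets-avoids-pendant origin W₀ (λ M → avoids n M ∧ Q (S₀ ∷ N₀ ∷ M)) refl origin-EK) ⟩
    countSubsets (λ M → covers n M ∧ Q (S₀ ∷ M)) (E₀ ∷ K) +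
    countSubsets (λ M → avoids n M ∧ Q (S₀ ∷ N₀ ∷ M)) (E₀ ∷ K)
      ≡⟨ cong₂ _+_ (countSubsets-covers-untouched n (λ M → Q (S₀ ∷ M)) n-EK)
                   (countSubsets-avoids-untouched n (λ M → Q (S₀ ∷ N₀ ∷ M)) n-EK) ⟩
    countSubsets (λ M → Q (S₀ ∷ N₀ ∷ M)) (E₀ ∷ K)
      ≡⟨ countSubsets-≗ (E₀ ∷ K) rungs ⟩
    countSubsets (λ M → Q (E₀ ∷ M)) (E₀ ∷ south e ∷ J)
      ≡⟨ ≡-trans (countSubsets-∷ (λ M → Q (E₀ ∷ M)) E₀ K)
                 (cong₂ _+_ (countSubsets-∷ (λ M → Q (E₀ ∷ M)) (south e) J) (countSubsets-none K e-doubled)) ⟩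
    (countSubsets (λ M → Q (E₀ ∷ M)) J + countSubsets (λ M → Q (E₀ ∷ south e ∷ M)) J) + 0
      ≡⟨ ≡-trans (+-identityʳ _)
                 (cong (countSubsets (λ M → Q (E₀ ∷ M)) J +_) (countSubsets-none J e-doubled′)) ⟩
    countSubsets (λ M → Q (E₀ ∷ M)) J + 0
      ≡⟨ ≡-trans (+-identityʳ _) (sym extensions-west) ⟩
    extensions e ds []
      ≡⟨ extensions-move East origin ds [] ⟩
    extensions origin ds [] ∎
    where
    P : List Edge → Bool
    P M = covers origin (S₀ ∷ M) ∧ (covers n (S₀ ∷ M) ∧ Q (S₀ ∷ M))

-- Snakes as coprime pairs

grow : Dir → ℕ × ℕ → ℕ × ℕ
grow North (b , g) = g , b + g
grow East  (b , g) = b + g , b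

-- Perfect matchings of the snake avoiding, resp. containing, the south edge of its first tile.
matchingCounts : List Dir → ℕ × ℕ
matchingCounts = foldr grow (1 , 1)

extensions-matchingCounts : ∀ ds →
  (extensions origin ds [] , extensions origin ds (south origin ∷ [])) ≡ matchingCounts ds
extensions-matchingCounts [] = refl
extensions-matchingCounts (North ∷ ds) = ≡-trans
  (cong₂ _,_ (NorthStep.extensions-North-avoiding ds) (NorthStep.extensions-North-using ds))
  (cong (grow North) (extensions-matchingCounts ds))
extensions-matchingCounts (East ∷ ds) = ≡-trans
  (cong₂ _,_ (EastStep.extensions-East-avoiding ds) (EastStep.extensions-East-using ds))
  (cong (grow East) (extensions-matchingCounts ds))

numPerfectMatchings-snake : ∀ ds → let (b , g) = matchingCounts ds in
  numPerfectMatchings (snakeGraph (just ds)) ≡ b + g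
numPerfectMatchings-snake ds = begin
  countSubsets (perfectOn (deduplicateᵇ _≡ᵖ_ (snakeVertices origin ds))) (snakeEdges origin ds)
    ≡⟨ countSubsets-≗ (snakeEdges origin ds) (perfectOn-dedup (snakeVertices origin ds)) ⟩
  countSubsets (perfectOn (snakeVertices origin ds)) (snakeEdges origin ds)
    ≡⟨ countSubsets-snake origin ds ⟩
  extensions origin ds [] + extensions origin ds (south origin ∷ [])
    ≡⟨ cong (λ (b , g) → b + g) (extensions-matchingCounts ds) ⟩
  proj₁ (matchingCounts ds) + proj₂ (matchingCounts ds) ∎

coprime-+⁻ : ∀ {m n} → Coprime (n + m) n → Coprime m n
coprime-+⁻ coprime (d∣m , d∣n) = coprime (∣m∣n⇒∣m+n d∣n d∣m , d∣n)

grow-positive : ∀ d {b g} → 1 ≤ b → 1 ≤ g → 1 ≤ proj₁ (grow d (b , g)) × 1 ≤ proj₂ (grow d (b , g))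
grow-positive North {b} 1≤b 1≤g = 1≤g , ≤-trans 1≤b (m≤m+n b _)
grow-positive East  {b} 1≤b 1≤g = ≤-trans 1≤b (m≤m+n b _) , 1≤b

grow-coprime : ∀ d {b g} → Coprime b g → Coprime (proj₁ (grow d (b , g))) (proj₂ (grow d (b , g)))
grow-coprime North {b} {g} coprime = subst (Coprime g) (+-comm g b) (Coprime.sym (coprime-+ coprime))
grow-coprime East  coprime = coprime-+ (Coprime.sym coprime)

matchingCounts-positive : ∀ ds → 1 ≤ proj₁ (matchingCounts ds) × 1 ≤ proj₂ (matchingCounts ds)
matchingCounts-positive [] = s≤s z≤n , s≤s z≤n
matchingCounts-positive (d ∷ ds) = let 1≤b , 1≤g = matchingCounts-positive ds in grow-positive d 1≤b 1≤g

matchingCounts-coprime : ∀ ds → Coprime (proj₁ (matchingCounts ds)) (proj₂ (matchingCounts ds))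
matchingCounts-coprime [] = 1-coprimeTo 1
matchingCounts-coprime (d ∷ ds) = grow-coprime d (matchingCounts-coprime ds)

-- Euclid's algorithm, run on a pair with fuel; it inverts matchingCounts.
pathTo : ℕ → ℕ × ℕ → List Dir
pathTo zero       _       = []
pathTo (suc fuel) (b , g) with <-cmp b g
... | tri< _ _ _ = North ∷ pathTo fuel (g ∸ b , b)
... | tri≈ _ _ _ = []
... | tri> _ _ _ = East ∷ pathTo fuel (g , b ∸ g)

smaller-summand : ∀ {m n f} → 1 ≤ m → m + n ≤ suc f → n ≤ f
smaller-summand {n = n} 1≤m m+n≤1+f = ≤-pred (≤-trans (m<n+m n 1≤m) m+n≤1+f)

matchingCounts-pathTo : ∀ fuel b g → 1 ≤ b → 1 ≤ g → Coprime b g → b + g ≤ fuel →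
  matchingCounts (pathTo fuel (b , g)) ≡ (b , g)
matchingCounts-pathTo zero (suc b) g _ _ _ ()
matchingCounts-pathTo (suc fuel) b g 1≤b 1≤g coprime bound with <-cmp b g
... | tri< b<g _ _ = ≡-trans (cong (grow North) IH) (cong (b ,_) (m∸n+n≡m (<⇒≤ b<g)))
  where
  IH : matchingCounts (pathTo fuel (g ∸ b , b)) ≡ (g ∸ b , b)
  IH = matchingCounts-pathTo fuel (g ∸ b) b (m<n⇒0<n∸m b<g) 1≤b
    (coprime-+⁻ (subst (λ x → Coprime x b) (sym (m+[n∸m]≡n (<⇒≤ b<g))) (Coprime.sym coprime)))
    (subst (_≤ fuel) (sym (m∸n+n≡m (<⇒≤ b<g))) (smaller-summand 1≤b bound))
... | tri≈ _ refl _ rewrite coprime (∣-refl , ∣-refl) = refl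
... | tri> _ _ g<b = ≡-trans (cong (grow East) IH) (cong (_, g) (m+[n∸m]≡n (<⇒≤ g<b)))
  where
  IH : matchingCounts (pathTo fuel (g , b ∸ g)) ≡ (g , b ∸ g)
  IH = matchingCounts-pathTo fuel g (b ∸ g) 1≤g (m<n⇒0<n∸m g<b)
    (Coprime.sym (coprime-+⁻ (subst (λ x → Coprime x g) (sym (m+[n∸m]≡n (<⇒≤ g<b))) coprime)))
    (subst (_≤ fuel) (sym (m+[n∸m]≡n (<⇒≤ g<b)))
           (smaller-summand 1≤g (subst (_≤ suc fuel) (+-comm b g) bound)))

pathTo-grow : ∀ d fuel {b g} → 1 ≤ b → 1 ≤ g → pathTo (suc fuel) (grow d (b , g)) ≡ d ∷ pathTo fuel (b , g)
pathTo-grow North fuel {b} {g} 1≤b 1≤g with <-cmp g (b + g)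
... | tri< _ _ _      = cong (λ x → North ∷ pathTo fuel (x , g)) (m+n∸n≡m b g)
... | tri≈ _ g≡b+g _  = ⊥-elim (<-irrefl g≡b+g (m<n+m g 1≤b))
... | tri> _ _ b+g<g  = ⊥-elim (<-asym b+g<g (m<n+m g 1≤b))
pathTo-grow East fuel {b} {g} 1≤b 1≤g with <-cmp (b + g) b
... | tri< b+g<b _ _  = ⊥-elim (<-asym b+g<b (m<m+n b 1≤g))
... | tri≈ _ b+g≡b _  = ⊥-elim (<-irrefl (sym b+g≡b) (m<m+n b 1≤g))
... | tri> _ _ _      = cong (λ x → East ∷ pathTo fuel (b , x)) (m+n∸m≡n b g)

grow-bound : ∀ d {b g f} → 1 ≤ b → 1 ≤ g →
  proj₁ (grow d (b , g)) + proj₂ (grow d (b , g)) ≤ suc f → b + g ≤ f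
grow-bound North     1≤b 1≤g bound = smaller-summand 1≤g bound
grow-bound East {b} {g} {f} 1≤b 1≤g bound = smaller-summand 1≤b (subst (_≤ suc f) (+-comm (b + g) b) bound)

pathTo-matchingCounts : ∀ ds fuel → proj₁ (matchingCounts ds) + proj₂ (matchingCounts ds) ≤ fuel →
  pathTo fuel (matchingCounts ds) ≡ ds
pathTo-matchingCounts [] (suc fuel) _ = refl
pathTo-matchingCounts (d ∷ ds) zero bound
  with ≤-trans (proj₁ (matchingCounts-positive (d ∷ ds))) (≤-trans (m≤m+n _ _) bound)
... | ()
pathTo-matchingCounts (d ∷ ds) (suc fuel) bound = ≡-trans (pathTo-grow d fuel 1≤b 1≤g)
  (cong (d ∷_) (pathTo-matchingCounts ds fuel (grow-bound d 1≤b 1≤g bound)))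
  where
  1≤b : 1 ≤ proj₁ (matchingCounts ds)
  1≤b = proj₁ (matchingCounts-positive ds)
  1≤g : 1 ≤ proj₂ (matchingCounts ds)
  1≤g = proj₂ (matchingCounts-positive ds)

-- (1 , 0) is the only coprime pair with positive first entry that matchingCounts misses.
snakePair : Snake → ℕ × ℕ
snakePair nothing   = 1 , 0
snakePair (just ds) = matchingCounts ds

snakeOf : ℕ × ℕ → Snake
snakeOf (b , zero)  = nothing
snakeOf (b , suc g) = just (pathTo (b + suc g) (b , suc g))

numPerfectMatchings-snakePair : ∀ s →
  numPerfectMatchings (snakeGraph s) ≡ proj₁ (snakePair s) + proj₂ (snakePair s)
numPerfectMatchings-snakePair nothing   = refl
numPerfectMatchings-snakePair (just ds) = numPerfectMatchings-snake ds

snakePair-positive : ∀ s → 1 ≤ proj₁ (snakePair s)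
snakePair-positive nothing   = s≤s z≤n
snakePair-positive (just ds) = proj₁ (matchingCounts-positive ds)

snakePair-coprime : ∀ s → Coprime (proj₁ (snakePair s)) (proj₂ (snakePair s))
snakePair-coprime nothing   = 1-coprimeTo 0
snakePair-coprime (just ds) = matchingCounts-coprime ds

snakePair-snakeOf : ∀ {b g} → 1 ≤ b → Coprime b g → snakePair (snakeOf (b , g)) ≡ (b , g)
snakePair-snakeOf {b} {zero} _ coprime rewrite 0-coprimeTo-m⇒m≡1 (Coprime.sym coprime) = refl
snakePair-snakeOf {b} {suc g} 1≤b coprime =
  matchingCounts-pathTo (b + suc g) b (suc g) 1≤b (s≤s z≤n) coprime ≤-refl

snakeOf-snakePair : ∀ s → snakeOf (snakePair s) ≡ s
snakeOf-snakePair nothing = refl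
snakeOf-snakePair (just ds)
  with matchingCounts ds | pathTo-matchingCounts ds | proj₂ (matchingCounts-positive ds)
... | b , suc g | inverse | _ = cong just (inverse (b + suc g) ≤-refl)

-- φ N is length (coprimeResidues N) by definition.
coprimeResidues : ℕ → List ℕ
coprimeResidues N = filter (λ k → gcd k N ≟ 1) (map suc (upTo N))

∈-coprimeResidues⁻ : ∀ {N k} → k ∈ coprimeResidues N → 1 ≤ k × k ≤ N × Coprime k N
∈-coprimeResidues⁻ {N} k∈ with ∈-filter⁻ (λ k → gcd k N ≟ 1) {xs = map suc (upTo N)} k∈
... | k∈range , gcd≡1 with ∈-map⁻ suc k∈range
...   | i , i∈upTo , refl = s≤s z≤n , ∈-upTo⁻ i∈upTo , gcd≡1⇒coprime gcd≡1

∈-coprimeResidues⁺ : ∀ {N k} → 1 ≤ k → k ≤ N → Coprime k N → k ∈ coprimeResidues N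
∈-coprimeResidues⁺ {N} {suc i} _ i<N coprime =
  ∈-filter⁺ (λ k → gcd k N ≟ 1) (∈-map⁺ suc (∈-upTo⁺ i<N)) (coprime⇒gcd≡1 coprime)

coprimeResidues-unique : ∀ N → Unique (coprimeResidues N)
coprimeResidues-unique N = Unique.filter⁺ _ (Unique.map⁺ suc-injective (Unique.upTo⁺ N))

snakesWith : ℕ → List Snake
snakesWith N = map (λ k → snakeOf (k , N ∸ k)) (coprimeResidues N)

snakePair-snakesWith : ∀ {N k} → k ∈ coprimeResidues N → snakePair (snakeOf (k , N ∸ k)) ≡ (k , N ∸ k)
snakePair-snakesWith {N} {k} k∈ =
  let 1≤k , k≤N , coprime = ∈-coprimeResidues⁻ k∈ in
  snakePair-snakeOf 1≤k
    (Coprime.sym (coprime-+⁻ (subst (λ n → Coprime n k) (sym (m+[n∸m]≡n k≤N)) (Coprime.sym coprime))))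

snakesWith-unique : ∀ N → Unique (snakesWith N)
snakesWith-unique N =
  Unique.map⁻ (subst Unique pairs (Unique.map⁺ (cong proj₁) (coprimeResidues-unique N)))
  where
  pairs : map (λ k → k , N ∸ k) (coprimeResidues N) ≡ map snakePair (snakesWith N)
  pairs = ≡-trans (sym (map-cong-local (All.tabulate snakePair-snakesWith))) (map-∘ (coprimeResidues N))

∈-snakesWith⁻ : ∀ {N s} → s ∈ snakesWith N → numPerfectMatchings (snakeGraph s) ≡ N
∈-snakesWith⁻ {N} s∈ with ∈-map⁻ (λ k → snakeOf (k , N ∸ k)) s∈
... | k , k∈ , refl = ≡-trans (numPerfectMatchings-snakePair (snakeOf (k , N ∸ k)))
  (≡-trans (cong (λ (b , g) → b + g) (snakePair-snakesWith k∈))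
           (m+[n∸m]≡n (proj₁ (proj₂ (∈-coprimeResidues⁻ k∈)))))

∈-snakesWith⁺ : ∀ {N} s → numPerfectMatchings (snakeGraph s) ≡ N → s ∈ snakesWith N
∈-snakesWith⁺ {N} s numPM≡N =
  subst (_∈ snakesWith N) snakeOf≡s (∈-map⁺ (λ k → snakeOf (k , N ∸ k)) b∈)
  where
  b g : ℕ
  b = proj₁ (snakePair s)
  g = proj₂ (snakePair s)
  b+g≡N : b + g ≡ N
  b+g≡N = ≡-trans (sym (numPerfectMatchings-snakePair s)) numPM≡N
  b∈ : b ∈ coprimeResidues N
  b∈ = ∈-coprimeResidues⁺ (snakePair-positive s) (subst (b ≤_) b+g≡N (m≤m+n b g))
         (subst (Coprime b) b+g≡N (Coprime.sym (coprime-+ (Coprime.sym (snakePair-coprime s)))))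
  snakeOf≡s : snakeOf (b , N ∸ b) ≡ s
  snakeOf≡s = ≡-trans (cong (λ n → snakeOf (b , n ∸ b)) (sym b+g≡N))
                      (≡-trans (cong (λ n → snakeOf (b , n)) (m+n∸m≡n b g)) (snakeOf-snakePair s))

corollary4p3 : (N : ℕ) → 1 ≤ N →
    Σ (List Snake) (λ L →
    Unique L × length L ≡ φ N ×
    ((s : Snake) → (s ∈ L) ⇔ (numPerfectMatchings (snakeGraph s) ≡ N)))
corollary4p3 N _ =
  snakesWith N , snakesWith-unique N , length-map _ (coprimeResidues N) ,
  λ s → mk⇔ ∈-snakesWith⁻ (∈-snakesWith⁺ s)
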